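{- Let $n=2k\ge 4$ and let $\tilde{\mathbf{B}}_n$ be the graph on vertices $0,1,\dots,n$ with simple edges $1-2$, $0-2$, $2-3,\dots,(n-2)-(n-1)$ and a double edge from the longer vertex $n-1$ to the shorter vertex $n$. Then $\tilde{\mathbf{B}}_n$ has exactly $k+5$ equivalence classes of labelings.
   Context: Generalized Reeder's puzzle: a labeling assigns $a_j\in\mathbb{Z}/2\mathbb{Z}$ to each vertex $j$. Some edges are double edges directed from a longer vertex to a shorter vertex. The move $T_i$ sends $a$ to $a'$ with $a'_j=a_j$ for $j\ne i$ and $a'_i=a_i+\sum_k a_k \pmod 2$, where $k$ runs over the neighbors of $i$ excluding any neighbor that is the shorter endpoint of a double edge at $i$. Two labelings are equivalent if related by a finite sequence of moves. -}

module Defs where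

open import Data.Nat using (ℕ; zero; suc; _+_; _*_; _∸_; _≡ᵇ_; _≤ᵇ_)
open import Data.Bool using (Bool; true; false; _∧_; _∨_; _xor_)
open import Data.Fin using (Fin; toℕ)
open import Data.Vec using (Vec; lookup; _[_]≔_; allFin; map; foldr′)
open import Data.Product using (Σ; ∃; _×_; _,_)
open import Relation.Binary.PropositionalEquality using (_≡_)
open import Relation.Binary.Construct.Closure.ReflexiveTransitive using (Star)

-- Z/2Z is represented by Bool, with addition = xor.
-- A labeling of a graph on vertices 0..n.
Labeling : ℕ → Set
Labeling n = Vec Bool (suc n)

-- A generalized graph on vertices Fin (suc n) is given by a Boolean
-- "contributes i j": j is a neighbour of i that is counted in the move T_i
-- (i.e. j is a neighbour of i, and not the shorter endpoint of a double edge at i).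
Contrib : ℕ → Set
Contrib n = Fin (suc n) → Fin (suc n) → Bool

move : ∀ {n} → Contrib n → Fin (suc n) → Labeling n → Labeling n
move {n} c i a =
  a [ i ]≔ (lookup a i xor foldr′ _xor_ false (map (λ j → c i j ∧ lookup a j) (allFin (suc n))))

Step : ∀ {n} → Contrib n → Labeling n → Labeling n → Set
Step c a b = ∃ λ i → b ≡ move c i a

Equiv : ∀ {n} → Contrib n → Labeling n → Labeling n → Set
Equiv c = Star (Step c)

HasExactlyClasses : ∀ {n} → Contrib n → ℕ → Set
HasExactlyClasses {n} c m =
  Σ (Fin m → Labeling n) λ rep →
    (∀ x y → Equiv c (rep x) (rep y) → x ≡ y) ×
    (∀ a → ∃ λ x → Equiv c a (rep x))

simpleDir : ℕ → ℕ → ℕ → Bool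
simpleDir n a b =
  ((a ≡ᵇ 1) ∧ (b ≡ᵇ 2)) ∨
  ((a ≡ᵇ 0) ∧ (b ≡ᵇ 2)) ∨
  ((2 ≤ᵇ a) ∧ (a ≤ᵇ n ∸ 2) ∧ (b ≡ᵇ suc a))

simpleAdj : ℕ → ℕ → ℕ → Bool
simpleAdj n a b = simpleDir n a b ∨ simpleDir n b a

-- Counted neighbours in B̃_n: simple neighbours, plus for vertex n (shorter)
-- the longer vertex n-1 of the double edge n-1 ⇒ n. For vertex n-1 the
-- shorter endpoint n is excluded.
Btilde : (n : ℕ) → Contrib n
Btilde n i j =
  simpleAdj n (toℕ i) (toℕ j) ∨ ((toℕ i ≡ᵇ n) ∧ (toℕ j ≡ᵇ n ∸ 1))

module Submission where

-- Merge the two leaves 0 and 1 into a single vertex labelled a₀ + a₁ and pad with zeros at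
-- both ends: the labels read z = (0, a₀ + a₁, a₂, …, aₙ₋₁, 0) along a path, and a move at any
-- vertex 1 ≤ p ≤ n − 1 replaces z_p by z_{p−1} + z_p + z_{p+1}.  On the differences
-- y_j = z_j + z_{j+1} (a word of length n and even weight) this is the transposition of
-- y_{p−1} and y_p.  So a labeling is the same as a triple (a₀, y, aₙ); the move at 0 also swaps
-- y₀, y₁ and adds y₀ + y₁ to a₀, and the move at n adds y_{n−1} to aₙ.  The number of ones in y
-- is invariant; a₀ is invariant when y is constant and aₙ when y = 0.  When y is not constant
-- one can bring it to the form 1 0 … 1 and then use the moves at 0 and n to clear a₀ and aₙ.
-- This gives 4 classes with y = 0, 2 with y = 1 and one for each even number 2, 4, …, n − 2
-- of zeros in y: k + 5 classes when n = 2k.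

open import Defs
open import Algebra.Bundles using (CommutativeRing)
import Algebra.Properties.CommutativeSemigroup as CommutativeSemigroupProperties
open import Data.Bool using (Bool; true; false; _∧_; _∨_; _xor_; not; if_then_else_)
open import Data.Bool.Properties
  using ( xor-identityʳ; xor-assoc; xor-comm; xor-same; not-involutive; ∧-distribʳ-xor; ∧-zeroʳ; ∨-identityʳ
        ; xor-∧-commutativeRing)
open import Data.Fin using (Fin; toℕ; fromℕ; fromℕ<)
open import Data.Fin.Properties using (toℕ-fromℕ; toℕ-fromℕ<; toℕ<n; toℕ-injective)
open import Data.List using (List; []; _∷_; _++_; length; replicate; foldr; applyUpTo)
open import Data.List.Properties using (length-applyUpTo; ∷-injective)
open import Data.List.Relation.Unary.All using (All; []; _∷_)
open import Data.Nat using (ℕ; zero; suc; _+_; _*_; _∸_; _≤_; _<_; z≤n; s≤s; _≡ᵇ_; _<ᵇ_; ⌊_/2⌋)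
open import Data.Nat.Properties
open import Data.Nat.Tactic.RingSolver using (solve-∀)
open import Data.Product using (_×_; _,_; ∃; ∃-syntax; proj₁; proj₂)
open import Data.Vec using (Vec; []; _∷_; lookup; _[_]≔_; allFin; map; foldr′; tabulate)
open import Data.Vec.Properties using (tabulate-∘)
open import Function using (_∘_; case_of_)
open import Relation.Binary.Construct.Closure.ReflexiveTransitive using (Star; ε; _◅_; _◅◅_; gmap; reverse)
open import Relation.Binary.PropositionalEquality
open import Relation.Nullary using (yes; no)
open import Relation.Nullary.Decidable using (dec-true; dec-false)

open CommutativeSemigroupProperties (CommutativeRing.+-commutativeSemigroup xor-∧-commutativeRing)
  using (xy∙z≈xz∙y; x∙yz≈y∙xz) renaming (interchange to xor-interchange)

trues : List Bool → ℕ
trues []           = 0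
trues (true  ∷ bs) = suc (trues bs)
trues (false ∷ bs) = trues bs

falses : List Bool → ℕ
falses []           = 0
falses (true  ∷ bs) = falses bs
falses (false ∷ bs) = suc (falses bs)

parity : List Bool → Bool
parity = foldr _xor_ false

odd : ℕ → Bool
odd zero    = false
odd (suc n) = not (odd n)

lastBit : List Bool → Bool
lastBit []           = false
lastBit (b ∷ [])     = b
lastBit (_ ∷ b ∷ bs) = lastBit (b ∷ bs)

sorted : ℕ → ℕ → List Bool
sorted f t = replicate f false ++ replicate t true

trues+falses≡length : ∀ bs → trues bs + falses bs ≡ length bs
trues+falses≡length []           = refl
trues+falses≡length (true  ∷ bs) = cong suc (trues+falses≡length bs)
trues+falses≡length (false ∷ bs) = trans (+-suc (trues bs) (falses bs)) (cong suc (trues+falses≡length bs))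

trues≡0⇒falses≡length : ∀ bs → trues bs ≡ 0 → falses bs ≡ length bs
trues≡0⇒falses≡length bs t≡0 = trans (cong (_+ falses bs) (sym t≡0)) (trues+falses≡length bs)

falses≡0⇒trues≡length : ∀ bs → falses bs ≡ 0 → trues bs ≡ length bs
falses≡0⇒trues≡length bs f≡0 =
  trans (sym (+-identityʳ (trues bs))) (trans (cong (trues bs +_) (sym f≡0)) (trues+falses≡length bs))

odd-trues : ∀ bs → odd (trues bs) ≡ parity bs
odd-trues []           = refl
odd-trues (true  ∷ bs) = cong not (odd-trues bs)
odd-trues (false ∷ bs) = odd-trues bs

odd-double : ∀ h → odd (h + h) ≡ false
odd-double zero    = refl
odd-double (suc h) rewrite +-suc h h = trans (not-involutive (odd (h + h))) (odd-double h)

even⇒double : ∀ n → odd n ≡ false → ∃[ h ] n ≡ h + h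
even⇒double zero          _ = 0 , refl
even⇒double (suc (suc n)) e with even⇒double n (trans (sym (not-involutive (odd n))) e)
... | h , refl = suc h , cong suc (sym (+-suc h h))

lastBit⇒trues : ∀ bs → lastBit bs ≡ true → ∃[ t ] trues bs ≡ suc t
lastBit⇒trues (true  ∷ [])     _ = 0 , refl
lastBit⇒trues (true  ∷ c ∷ bs) _ = trues (c ∷ bs) , refl
lastBit⇒trues (false ∷ c ∷ bs) e = lastBit⇒trues (c ∷ bs) e

trues-sorted : ∀ f t → trues (sorted f t) ≡ t
trues-sorted (suc f) t       = trues-sorted f t
trues-sorted zero    zero    = refl
trues-sorted zero    (suc t) = cong suc (trues-sorted zero t)

falses-sorted : ∀ f t → falses (sorted f t) ≡ f
falses-sorted (suc f) t       = cong suc (falses-sorted f t)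
falses-sorted zero    zero    = refl
falses-sorted zero    (suc t) = falses-sorted zero t

lastBit-sorted : ∀ f t → lastBit (sorted f (suc t)) ≡ true
lastBit-sorted zero          zero    = refl
lastBit-sorted zero          (suc t) = lastBit-sorted zero t
lastBit-sorted (suc zero)    t       = lastBit-sorted zero t
lastBit-sorted (suc (suc f)) t       = lastBit-sorted (suc f) t

-- Adjacent transpositions

swapAt : ∀ {A : Set} → ℕ → List A → List A
swapAt zero    (x ∷ y ∷ xs) = y ∷ x ∷ xs
swapAt (suc q) (x ∷ xs)     = x ∷ swapAt q xs
swapAt _       xs           = xs

module _ {A : Set} where

  infix 4 _⇄_ _⇄⋆_

  _⇄_ : List A → List A → Set
  xs ⇄ ys = ∃[ q ] suc q < length xs × ys ≡ swapAt q xs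

  _⇄⋆_ : List A → List A → Set
  _⇄⋆_ = Star _⇄_

  length-swapAt : ∀ q (xs : List A) → length (swapAt q xs) ≡ length xs
  length-swapAt zero    []           = refl
  length-swapAt zero    (x ∷ [])     = refl
  length-swapAt zero    (x ∷ y ∷ xs) = refl
  length-swapAt (suc q) []           = refl
  length-swapAt (suc q) (x ∷ xs)     = cong suc (length-swapAt q xs)

  swapAt-involutive : ∀ q (xs : List A) → swapAt q (swapAt q xs) ≡ xs
  swapAt-involutive zero    []           = refl
  swapAt-involutive zero    (x ∷ [])     = refl
  swapAt-involutive zero    (x ∷ y ∷ xs) = refl
  swapAt-involutive (suc q) []           = refl
  swapAt-involutive (suc q) (x ∷ xs)     = cong (x ∷_) (swapAt-involutive q xs)

  ⇄-sym : ∀ {xs ys} → xs ⇄ ys → ys ⇄ xs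
  ⇄-sym {xs} (q , q<n , refl) =
    q , subst (suc q <_) (sym (length-swapAt q xs)) q<n , sym (swapAt-involutive q xs)

  ⇄-prep : ∀ x {xs ys} → xs ⇄ ys → x ∷ xs ⇄ x ∷ ys
  ⇄-prep x (q , q<n , refl) = suc q , s≤s q<n , refl

  ⇄⋆-prep : ∀ x {xs ys} → xs ⇄⋆ ys → x ∷ xs ⇄⋆ x ∷ ys
  ⇄⋆-prep x = gmap (x ∷_) (⇄-prep x)

  ⇄⋆-sym : ∀ {xs ys} → xs ⇄⋆ ys → ys ⇄⋆ xs
  ⇄⋆-sym = reverse ⇄-sym

  applyUpTo-cong : ∀ n {f g : ℕ → A} → (∀ j → j < n → f j ≡ g j) → applyUpTo f n ≡ applyUpTo g n
  applyUpTo-cong zero    eq = refl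
  applyUpTo-cong (suc n) eq = cong₂ _∷_ (eq 0 (s≤s z≤n)) (applyUpTo-cong n (λ j j< → eq (suc j) (s≤s j<)))

  applyUpTo-≡⇒≗ : ∀ n {f g : ℕ → A} → applyUpTo f n ≡ applyUpTo g n → ∀ j → j < n → f j ≡ g j
  applyUpTo-≡⇒≗ (suc n) eq zero    _         = proj₁ (∷-injective eq)
  applyUpTo-≡⇒≗ (suc n) eq (suc j) (s≤s j<n) = applyUpTo-≡⇒≗ n (proj₂ (∷-injective eq)) j j<n

  applyUpTo-swapAt : ∀ q n {f g : ℕ → A} → suc q < n →
                     g q ≡ f (suc q) → g (suc q) ≡ f q → (∀ j → j ≢ q → j ≢ suc q → g j ≡ f j) →
                     applyUpTo g n ≡ swapAt q (applyUpTo f n)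
  applyUpTo-swapAt zero    (suc zero)    (s≤s ()) _ _ _
  applyUpTo-swapAt zero    (suc (suc n)) _ g₀ g₁ others =
    cong₂ _∷_ g₀ (cong₂ _∷_ g₁ (applyUpTo-cong n (λ j _ → others (2 + j) (λ ()) (λ ()))))
  applyUpTo-swapAt (suc q) (suc n) (s≤s q<n) g-q g-sq others =
    cong₂ _∷_ (others 0 (λ ()) (λ ()))
              (applyUpTo-swapAt q n q<n g-q g-sq
                 (λ j j≢q j≢sq → others (suc j) (j≢q ∘ suc-injective) (j≢sq ∘ suc-injective)))

trues-swapAt : ∀ q bs → trues (swapAt q bs) ≡ trues bs
trues-swapAt zero    []                   = refl
trues-swapAt zero    (b ∷ [])             = refl
trues-swapAt zero    (true  ∷ true  ∷ bs) = refl
trues-swapAt zero    (true  ∷ false ∷ bs) = refl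
trues-swapAt zero    (false ∷ true  ∷ bs) = refl
trues-swapAt zero    (false ∷ false ∷ bs) = refl
trues-swapAt (suc q) []                   = refl
trues-swapAt (suc q) (true  ∷ bs)         = cong suc (trues-swapAt q bs)
trues-swapAt (suc q) (false ∷ bs)         = trues-swapAt q bs

falses-swapAt : ∀ q bs → falses (swapAt q bs) ≡ falses bs
falses-swapAt zero    []                   = refl
falses-swapAt zero    (b ∷ [])             = refl
falses-swapAt zero    (true  ∷ true  ∷ bs) = refl
falses-swapAt zero    (true  ∷ false ∷ bs) = refl
falses-swapAt zero    (false ∷ true  ∷ bs) = refl
falses-swapAt zero    (false ∷ false ∷ bs) = refl
falses-swapAt (suc q) []                   = refl
falses-swapAt (suc q) (true  ∷ bs)         = falses-swapAt q bs
falses-swapAt (suc q) (false ∷ bs)         = cong suc (falses-swapAt q bs)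

true-bubbles : ∀ f bs → true ∷ replicate f false ++ bs ⇄⋆ replicate f false ++ true ∷ bs
true-bubbles zero    bs = ε
true-bubbles (suc f) bs = (0 , s≤s (s≤s z≤n) , refl) ◅ ⇄⋆-prep false (true-bubbles f bs)

⇄⋆-sorted : ∀ bs → bs ⇄⋆ sorted (falses bs) (trues bs)
⇄⋆-sorted []           = ε
⇄⋆-sorted (false ∷ bs) = ⇄⋆-prep false (⇄⋆-sorted bs)
⇄⋆-sorted (true  ∷ bs) =
  ⇄⋆-prep true (⇄⋆-sorted bs) ◅◅ true-bubbles (falses bs) (replicate (trues bs) true)

⇄⋆-same-counts : ∀ bs cs → trues bs ≡ trues cs → falses bs ≡ falses cs → bs ⇄⋆ cs
⇄⋆-same-counts bs cs t≡ f≡ =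
  ⇄⋆-sorted bs ◅◅ subst₂ (λ f t → sorted f t ⇄⋆ cs) (sym f≡) (sym t≡) (⇄⋆-sym (⇄⋆-sorted cs))

-- Moves in coordinates (a₀, y, aₙ)

Coordinates : Set
Coordinates = Bool × List Bool × Bool

infix 4 _⟶_ _⟶⋆_

-- The effect of a move at a vertex 1 ≤ p ≤ n − 1, at 0, and at n respectively.
data _⟶_ : Coordinates → Coordinates → Set where
  transpose   : ∀ {a₀ ys ys′ aₙ} → ys ⇄ ys′ → (a₀ , ys , aₙ) ⟶ (a₀ , ys′ , aₙ)
  swap-first  : ∀ {a₀ y₀ y₁ ys aₙ} →
                (a₀ , y₀ ∷ y₁ ∷ ys , aₙ) ⟶ (a₀ xor (y₀ xor y₁) , y₁ ∷ y₀ ∷ ys , aₙ)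
  toggle-last : ∀ {a₀ ys aₙ} → (a₀ , ys , aₙ) ⟶ (a₀ , ys , aₙ xor lastBit ys)

_⟶⋆_ : Coordinates → Coordinates → Set
_⟶⋆_ = Star _⟶_

transpose⋆ : ∀ {a₀ ys ys′ aₙ} → ys ⇄⋆ ys′ → (a₀ , ys , aₙ) ⟶⋆ (a₀ , ys′ , aₙ)
transpose⋆ {a₀} {aₙ = aₙ} = gmap (λ ys → a₀ , ys , aₙ) transpose

reset-last : ∀ a₀ ys aₙ → lastBit ys ≡ true → (a₀ , ys , aₙ) ⟶⋆ (a₀ , ys , false)
reset-last a₀ ys false _    = ε
reset-last a₀ ys true  last =
  subst (λ b → (a₀ , ys , true) ⟶ (a₀ , ys , true xor b)) last toggle-last ◅ ε

reset-first : ∀ a₀ ys → (a₀ , true ∷ false ∷ ys , false) ⟶⋆ (false , true ∷ false ∷ ys , false)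
reset-first false ys = ε
reset-first true  ys = swap-first ◅ transpose (0 , s≤s (s≤s z≤n) , refl) ◅ ε

reset-ends : ∀ a₀ ys aₙ → lastBit (false ∷ ys) ≡ true →
             (a₀ , true ∷ false ∷ ys , aₙ) ⟶⋆ (false , true ∷ false ∷ ys , false)
reset-ends a₀ ys aₙ last = reset-last a₀ (true ∷ false ∷ ys) aₙ last ◅◅ reset-first a₀ ys

bit : Bool → ℕ
bit b = if b then 1 else 0

classIndex′ : ℕ → ℕ → Bool → Bool → ℕ
classIndex′ zero    _       a₀ aₙ = bit a₀ + bit a₀ + bit aₙ
classIndex′ (suc _) zero    a₀ _  = 4 + bit a₀
classIndex′ (suc _) (suc f) _  _  = 5 + ⌊ suc f /2⌋

classIndex : Coordinates → ℕ
classIndex (a₀ , ys , aₙ) = classIndex′ (trues ys) (falses ys) a₀ aₙ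

classIndex-⟶ : ∀ {c c′} → c ⟶ c′ → classIndex c ≡ classIndex c′
classIndex-⟶ (transpose {a₀ = a₀} {ys} {aₙ = aₙ} (q , _ , refl)) =
  sym (cong₂ (λ t f → classIndex′ t f a₀ aₙ) (trues-swapAt q ys) (falses-swapAt q ys))
classIndex-⟶ (swap-first {a₀} {true}  {true}  {ys} {aₙ}) =
  cong (λ b → classIndex′ (suc (suc (trues ys))) (falses ys) b aₙ) (sym (xor-identityʳ a₀))
classIndex-⟶ (swap-first {a₀} {true}  {false}) = refl
classIndex-⟶ (swap-first {a₀} {false} {true})  = refl
classIndex-⟶ (swap-first {a₀} {false} {false} {ys} {aₙ}) =
  cong (λ b → classIndex′ (trues ys) (suc (suc (falses ys))) b aₙ) (sym (xor-identityʳ a₀))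
classIndex-⟶ (toggle-last {a₀} {ys} {aₙ}) with lastBit ys in last
... | false = cong (classIndex′ (trues ys) (falses ys) a₀) (sym (xor-identityʳ aₙ))
... | true with lastBit⇒trues ys last
...   | _ , t≡ rewrite t≡ with falses ys
...     | zero  = refl
...     | suc _ = refl

classIndex-⟶⋆ : ∀ {c c′} → c ⟶⋆ c′ → classIndex c ≡ classIndex c′
classIndex-⟶⋆ ε        = refl
classIndex-⟶⋆ (s ◅ ss) = trans (classIndex-⟶ s) (classIndex-⟶⋆ ss)

Admissible : ℕ → Coordinates → Set
Admissible m (_ , ys , _) = length ys ≡ 4 + (m + m) × parity ys ≡ false

admissible-by-counts : ∀ m ys h → trues ys ≡ h + h → trues ys + falses ys ≡ 4 + (m + m) →
                       length ys ≡ 4 + (m + m) × parity ys ≡ false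
admissible-by-counts m ys h t≡ total =
  trans (sym (trues+falses≡length ys)) total , trans (sym (odd-trues ys)) (trans (cong odd t≡) (odd-double h))

-- For n = 4 + 2m; the index 6 + u is junk unless u ≤ m.
representative : ℕ → ℕ → Coordinates
representative m 0 = false , sorted (4 + (m + m)) 0 , false
representative m 1 = false , sorted (4 + (m + m)) 0 , true
representative m 2 = true  , sorted (4 + (m + m)) 0 , false
representative m 3 = true  , sorted (4 + (m + m)) 0 , true
representative m 4 = false , sorted 0 (4 + (m + m)) , false
representative m 5 = true  , sorted 0 (4 + (m + m)) , false
representative m (suc (suc (suc (suc (suc (suc u)))))) =
  false , true ∷ sorted (2 + (u + u)) (suc (m ∸ u + (m ∸ u))) , false

+2-double : ∀ m → 4 + (m + m) ≡ (2 + m) + (2 + m)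
+2-double = solve-∀

double-split : ∀ h f m → h + h + f ≡ m + m → ∃[ u ] f ≡ u + u × h + u ≡ m
double-split zero    f m       e = m , e , refl
double-split (suc h) f zero    ()
double-split (suc h) f (suc m) e rewrite +-suc h h | +-suc m m
  with u , f≡ , h+u≡m ← double-split h f m (suc-injective (suc-injective e)) = u , f≡ , cong suc h+u≡m

mixed-split : ∀ h f m → suc h + suc h + suc f ≡ 4 + (m + m) → ∃[ u ] f ≡ suc (u + u) × h + u ≡ m
mixed-split h f m e with double-split (suc h) (suc f) (2 + m) (trans e (+2-double m))
... | zero  , ()  , _
... | suc u , f≡ , h+u≡ =
  u , trans (suc-injective f≡) (+-suc u u) , suc-injective (trans (sym (+-suc h u)) (suc-injective h+u≡))

module Classification (m : ℕ) where

  private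
    n : ℕ
    n = 4 + (m + m)

  reach-all-false : ∀ a₀ ys aₙ → trues ys ≡ 0 → length ys ≡ n →
                    (a₀ , ys , aₙ) ⟶⋆ (a₀ , sorted n 0 , aₙ)
  reach-all-false a₀ ys aₙ t≡0 len = transpose⋆ (⇄⋆-same-counts ys (sorted n 0)
    (trans t≡0 (sym (trues-sorted n 0)))
    (trans (trans (trues≡0⇒falses≡length ys t≡0) len) (sym (falses-sorted n 0))))

  reach-all-true : ∀ a₀ ys aₙ → falses ys ≡ 0 → length ys ≡ n →
                   (a₀ , ys , aₙ) ⟶⋆ (a₀ , sorted 0 n , false)
  reach-all-true a₀ ys aₙ f≡0 len =
    transpose⋆ (⇄⋆-same-counts ys (sorted 0 n)
      (trans (trans (falses≡0⇒trues≡length ys f≡0) len) (sym (trues-sorted 0 n)))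
      (trans f≡0 (sym (falses-sorted 0 n))))
    ◅◅ reset-last a₀ (sorted 0 n) aₙ (lastBit-sorted 0 (3 + (m + m)))

  reach-mixed : ∀ a₀ ys aₙ u h → trues ys ≡ 2 + (h + h) → falses ys ≡ 2 + (u + u) →
                (a₀ , ys , aₙ) ⟶⋆ (false , true ∷ sorted (2 + (u + u)) (suc (h + h)) , false)
  reach-mixed a₀ ys aₙ u h t≡ f≡ =
    transpose⋆ (⇄⋆-same-counts ys target
      (trans t≡ (cong suc (sym (trues-sorted (2 + (u + u)) (suc (h + h))))))
      (trans f≡ (sym (falses-sorted (2 + (u + u)) (suc (h + h))))))
    ◅◅ reset-ends a₀ (sorted (1 + (u + u)) (suc (h + h))) aₙ (lastBit-sorted (2 + (u + u)) (h + h))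
    where target = true ∷ sorted (2 + (u + u)) (suc (h + h))

  representative-all-false : ∀ a₀ aₙ → let i = bit a₀ + bit a₀ + bit aₙ in
                             i < 7 + m × representative m i ≡ (a₀ , sorted n 0 , aₙ)
  representative-all-false false false = s≤s z≤n , refl
  representative-all-false false true  = s≤s (s≤s z≤n) , refl
  representative-all-false true  false = s≤s (s≤s (s≤s z≤n)) , refl
  representative-all-false true  true  = s≤s (s≤s (s≤s (s≤s z≤n))) , refl

  representative-all-true : ∀ a₀ →
                            4 + bit a₀ < 7 + m × representative m (4 + bit a₀) ≡ (a₀ , sorted 0 n , false)
  representative-all-true false = s≤s (s≤s (s≤s (s≤s (s≤s z≤n)))) , refl
  representative-all-true true  = s≤s (s≤s (s≤s (s≤s (s≤s (s≤s z≤n))))) , refl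

  reach-representative : ∀ c → Admissible m c →
                         classIndex c < 7 + m × c ⟶⋆ representative m (classIndex c)
  reach-representative (a₀ , ys , aₙ) (len , par) with trues ys in t≡
  ... | zero with bound , rep≡ ← representative-all-false a₀ aₙ =
    bound , subst (_ ⟶⋆_) (sym rep≡) (reach-all-false a₀ ys aₙ t≡ len)
  ... | suc _ with falses ys in f≡
  ...   | zero with bound , rep≡ ← representative-all-true a₀ =
    bound , subst (_ ⟶⋆_) (sym rep≡) (reach-all-true a₀ ys aₙ f≡ len)
  ...   | suc f with even⇒double (trues ys) (trans (odd-trues ys) par)
  ...     | zero  , h≡ = case trans (sym t≡) h≡ of λ ()
  ...     | suc h , h≡
    with mixed-split h f m (trans (cong₂ _+_ (sym h≡) (sym f≡)) (trans (trues+falses≡length ys) len))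
  ...       | u , refl , h+u≡m rewrite sym (n≡⌊n+n/2⌋ u) =
    +-monoʳ-≤ 7 (subst (u ≤_) h+u≡m (m≤n+m u h)) ,
    subst (λ k → (a₀ , ys , aₙ) ⟶⋆ (false , true ∷ sorted (2 + (u + u)) (suc (k + k)) , false)) h≡m∸u
          (reach-mixed a₀ ys aₙ u h (trans h≡ (cong suc (+-suc h h))) f≡)
    where h≡m∸u = trans (sym (m+n∸n≡m h u)) (cong (_∸ u) h+u≡m)

  classIndex-representative : ∀ i → classIndex (representative m i) ≡ i
  classIndex-representative 0 rewrite trues-sorted n 0 = refl
  classIndex-representative 1 rewrite trues-sorted n 0 = refl
  classIndex-representative 2 rewrite trues-sorted n 0 = refl
  classIndex-representative 3 rewrite trues-sorted n 0 = refl
  classIndex-representative 4 =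
    cong₂ (λ t f → classIndex′ t f false false) (trues-sorted 0 n) (falses-sorted 0 n)
  classIndex-representative 5 =
    cong₂ (λ t f → classIndex′ t f true false) (trues-sorted 0 n) (falses-sorted 0 n)
  classIndex-representative (suc (suc (suc (suc (suc (suc u)))))) =
    trans (cong (λ f → classIndex′ (suc (trues ys)) f false false) (falses-sorted (2 + (u + u)) _))
          (cong (6 +_) (sym (n≡⌊n+n/2⌋ u)))
    where ys = sorted (2 + (u + u)) (suc (m ∸ u + (m ∸ u)))

  all-false-admissible : length (sorted n 0) ≡ n × parity (sorted n 0) ≡ false
  all-false-admissible =
    admissible-by-counts m (sorted n 0) 0 (trues-sorted n 0) (cong₂ _+_ (trues-sorted n 0) (falses-sorted n 0))

  all-true-admissible : length (sorted 0 n) ≡ n × parity (sorted 0 n) ≡ false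
  all-true-admissible = admissible-by-counts m (sorted 0 n) (2 + m) (trans (trues-sorted 0 n) (+2-double m))
                          (trans (cong₂ _+_ (trues-sorted 0 n) (falses-sorted 0 n)) (+-identityʳ n))

  representative-admissible : ∀ i → i < 7 + m → Admissible m (representative m i)
  representative-admissible 0 _ = all-false-admissible
  representative-admissible 1 _ = all-false-admissible
  representative-admissible 2 _ = all-false-admissible
  representative-admissible 3 _ = all-false-admissible
  representative-admissible 4 _ = all-true-admissible
  representative-admissible 5 _ = all-true-admissible
  representative-admissible (suc (suc (suc (suc (suc (suc u)))))) 6+u<7+m =
    admissible-by-counts m (true ∷ ys) (suc k)
      (cong suc (trans (trues-sorted (2 + (u + u)) (suc (k + k))) (sym (+-suc k k))))
      (trans (cong₂ (λ t f → suc t + f) (trues-sorted (2 + (u + u)) (suc (k + k))) (falses-sorted (2 + (u + u)) _))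
             (trans (count-sum k u) (cong (λ x → 4 + (x + x)) (m∸n+n≡m (+-cancelˡ-≤ 7 u m 6+u<7+m)))))
    where
    k = m ∸ u
    ys = sorted (2 + (u + u)) (suc (k + k))
    count-sum : ∀ k u → 2 + (k + k) + (2 + (u + u)) ≡ 4 + ((k + u) + (k + u))
    count-sum = solve-∀

at : ∀ {m} → Vec Bool m → ℕ → Bool
at []       _       = false
at (b ∷ bs) zero    = b
at (b ∷ bs) (suc j) = at bs j

update : (ℕ → Bool) → ℕ → Bool → ℕ → Bool
update f p b j = if p ≡ᵇ j then b else f j

lookup≡at : ∀ {m} (v : Vec Bool m) i → lookup v i ≡ at v (toℕ i)
lookup≡at (b ∷ bs) Fin.zero    = refl
lookup≡at (b ∷ bs) (Fin.suc i) = lookup≡at bs i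

at-[]≔ : ∀ {m} (v : Vec Bool m) i b j → at (v [ i ]≔ b) j ≡ update (at v) (toℕ i) b j
at-[]≔ (_ ∷ _)  Fin.zero    b zero    = refl
at-[]≔ (_ ∷ _)  Fin.zero    b (suc j) = refl
at-[]≔ (_ ∷ _)  (Fin.suc i) b zero    = refl
at-[]≔ (_ ∷ bs) (Fin.suc i) b (suc j) = at-[]≔ bs i b j

at-injective : ∀ {m} (u v : Vec Bool m) → (∀ j → j < m → at u j ≡ at v j) → u ≡ v
at-injective []       []       _  = refl
at-injective (b ∷ bs) (c ∷ cs) eq =
  cong₂ _∷_ (eq 0 (s≤s z≤n)) (at-injective bs cs (λ j j< → eq (suc j) (s≤s j<)))

at-tabulate : ∀ m (h : ℕ → Bool) j → j < m → at (tabulate {n = m} (λ i → h (toℕ i))) j ≡ h j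
at-tabulate (suc m) h zero    _         = refl
at-tabulate (suc m) h (suc j) (s≤s j<m) = at-tabulate m (λ t → h (suc t)) j j<m

update-same : ∀ f p b → update f p b p ≡ b
update-same f p b rewrite dec-true (p ≟ p) refl = refl

update-other : ∀ f p b j → p ≢ j → update f p b j ≡ f j
update-other f p b j p≢j rewrite dec-false (p ≟ j) p≢j = refl

xor-absorb : ∀ a c → a xor (a xor c) ≡ c
xor-absorb a c = trans (sym (xor-assoc a a c)) (cong (_xor c) (xor-same a))

xor-cancelʳ : ∀ a c → (a xor c) xor c ≡ a
xor-cancelʳ a c = trans (xor-assoc a c c) (trans (cong (a xor_) (xor-same c)) (xor-identityʳ a))

xorSum : (ℕ → Bool) → ℕ → Bool
xorSum g zero    = false
xorSum g (suc m) = g 0 xor xorSum (λ t → g (suc t)) m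

δ : ℕ → ℕ → Bool
δ q t = t ≡ᵇ q

indicator : List ℕ → ℕ → Bool
indicator qs t = foldr (λ q b → δ q t xor b) false qs

xorOver : (ℕ → Bool) → List ℕ → Bool
xorOver f = foldr (λ q b → f q xor b) false

foldr-tabulate≡xorSum : ∀ {m} (h : Fin m → Bool) g → (∀ i → h i ≡ g (toℕ i)) →
                        foldr′ _xor_ false (tabulate h) ≡ xorSum g m
foldr-tabulate≡xorSum {zero}  h g eq = refl
foldr-tabulate≡xorSum {suc m} h g eq =
  cong₂ _xor_ (eq Fin.zero) (foldr-tabulate≡xorSum (h ∘ Fin.suc) (g ∘ suc) (eq ∘ Fin.suc))

xorSum-cong : ∀ m {g h} → (∀ t → g t ≡ h t) → xorSum g m ≡ xorSum h m
xorSum-cong zero    eq = refl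
xorSum-cong (suc m) eq = cong₂ _xor_ (eq 0) (xorSum-cong m (λ t → eq (suc t)))

xorSum-false : ∀ m → xorSum (λ _ → false) m ≡ false
xorSum-false zero    = refl
xorSum-false (suc m) = xorSum-false m

xorSum-xor : ∀ m g h → xorSum (λ t → g t xor h t) m ≡ xorSum g m xor xorSum h m
xorSum-xor zero    g h = refl
xorSum-xor (suc m) g h =
  trans (cong ((g 0 xor h 0) xor_) (xorSum-xor m _ _)) (xor-interchange (g 0) (h 0) _ _)

xorSum-δ : ∀ m q f → q < m → xorSum (λ t → δ q t ∧ f t) m ≡ f q
xorSum-δ (suc m) zero    f _         = trans (cong (f 0 xor_) (xorSum-false m)) (xor-identityʳ (f 0))
xorSum-δ (suc m) (suc q) f (s≤s q<m) = xorSum-δ m q (λ t → f (suc t)) q<m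

xorSum-indicator : ∀ m qs f → All (_< m) qs → xorSum (λ t → indicator qs t ∧ f t) m ≡ xorOver f qs
xorSum-indicator m []       f []           = xorSum-false m
xorSum-indicator m (q ∷ qs) f (q<m ∷ qs<m) = begin
  xorSum (λ t → (δ q t xor indicator qs t) ∧ f t) m
    ≡⟨ xorSum-cong m (λ t → ∧-distribʳ-xor (f t) (δ q t) (indicator qs t)) ⟩
  xorSum (λ t → (δ q t ∧ f t) xor (indicator qs t ∧ f t)) m
    ≡⟨ xorSum-xor m _ _ ⟩
  xorSum (λ t → δ q t ∧ f t) m xor xorSum (λ t → indicator qs t ∧ f t) m
    ≡⟨ cong₂ _xor_ (xorSum-δ m q f q<m) (xorSum-indicator m qs f qs<m) ⟩
  f q xor xorOver f qs ∎
  where open ≡-Reasoning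

-- Consecutive differences

Δ : (ℕ → Bool) → ℕ → Bool
Δ z j = z j xor z (suc j)

flipAt : (ℕ → Bool) → ℕ → ℕ → Bool
flipAt z p = update z p (z p xor (z (p ∸ 1) xor z (suc p)))

Δ-flip-left : ∀ z q → Δ (flipAt z (suc q)) q ≡ Δ z (suc q)
Δ-flip-left z q = begin
  flipAt z (suc q) q xor flipAt z (suc q) (suc q)
    ≡⟨ cong₂ _xor_ (update-other z (suc q) _ q 1+n≢n) (update-same z (suc q) _) ⟩
  z q xor (z (suc q) xor (z q xor z (2 + q)))
    ≡⟨ x∙yz≈y∙xz (z q) (z (suc q)) _ ⟩
  z (suc q) xor (z q xor (z q xor z (2 + q)))
    ≡⟨ cong (z (suc q) xor_) (xor-absorb (z q) (z (2 + q))) ⟩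
  z (suc q) xor z (2 + q) ∎
  where open ≡-Reasoning

Δ-flip-right : ∀ z q → Δ (flipAt z (suc q)) (suc q) ≡ Δ z q
Δ-flip-right z q = begin
  flipAt z (suc q) (suc q) xor flipAt z (suc q) (2 + q)
    ≡⟨ cong₂ _xor_ (update-same z (suc q) _) (update-other z (suc q) _ (2 + q) (1+n≢n ∘ sym)) ⟩
  (z (suc q) xor (z q xor z (2 + q))) xor z (2 + q)
    ≡⟨ xor-assoc (z (suc q)) _ _ ⟩
  z (suc q) xor ((z q xor z (2 + q)) xor z (2 + q))
    ≡⟨ cong (z (suc q) xor_) (xor-cancelʳ (z q) (z (2 + q))) ⟩
  z (suc q) xor z q
    ≡⟨ xor-comm (z (suc q)) (z q) ⟩
  z q xor z (suc q) ∎
  where open ≡-Reasoning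

Δ-flip-other : ∀ z q j → j ≢ q → j ≢ suc q → Δ (flipAt z (suc q)) j ≡ Δ z j
Δ-flip-other z q j j≢q j≢sq = cong₂ _xor_ (update-other z (suc q) _ j (j≢sq ∘ sym))
                                          (update-other z (suc q) _ (suc j) (j≢q ∘ suc-injective ∘ sym))

Δ-determines : ∀ m (z w : ℕ → Bool) → z 0 ≡ w 0 → (∀ j → j < m → Δ z j ≡ Δ w j) →
               ∀ j → j ≤ m → z j ≡ w j
Δ-determines m z w z₀≡ Δ≡ zero    _   = z₀≡
Δ-determines m z w z₀≡ Δ≡ (suc j) j<m = begin
  z (suc j)      ≡⟨ sym (xor-absorb (z j) (z (suc j))) ⟩
  z j xor Δ z j  ≡⟨ cong₂ _xor_ (Δ-determines m z w z₀≡ Δ≡ j (≤-trans (n≤1+n j) j<m)) (Δ≡ j j<m) ⟩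
  w j xor Δ w j  ≡⟨ xor-absorb (w j) (w (suc j)) ⟩
  w (suc j)      ∎
  where open ≡-Reasoning

parity-Δ : ∀ n z → parity (applyUpTo (Δ z) n) ≡ z 0 xor z n
parity-Δ zero    z = sym (xor-same (z 0))
parity-Δ (suc n) z = begin
  Δ z 0 xor parity (applyUpTo (Δ (z ∘ suc)) n) ≡⟨ cong (Δ z 0 xor_) (parity-Δ n (z ∘ suc)) ⟩
  (z 0 xor z 1) xor (z 1 xor z (suc n))         ≡⟨ xor-assoc (z 0) (z 1) _ ⟩
  z 0 xor (z 1 xor (z 1 xor z (suc n)))         ≡⟨ cong (z 0 xor_) (xor-absorb (z 1) (z (suc n))) ⟩
  z 0 xor z (suc n)                             ∎
  where open ≡-Reasoning

lastBit-applyUpTo : ∀ n g → lastBit (applyUpTo g (suc n)) ≡ g n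
lastBit-applyUpTo zero    g = refl
lastBit-applyUpTo (suc n) g = lastBit-applyUpTo n (g ∘ suc)

prefixParity : List Bool → ℕ → Bool
prefixParity _        zero    = false
prefixParity []       (suc j) = false
prefixParity (y ∷ ys) (suc j) = y xor prefixParity ys j

prefixParity-length : ∀ ys → prefixParity ys (length ys) ≡ parity ys
prefixParity-length []       = refl
prefixParity-length (y ∷ ys) = cong (y xor_) (prefixParity-length ys)

Δ-prefixParity : ∀ ys → applyUpTo (Δ (prefixParity ys)) (length ys) ≡ ys
Δ-prefixParity []       = refl
Δ-prefixParity (y ∷ ys) =
  cong₂ _∷_ (xor-identityʳ y) (trans (applyUpTo-cong (length ys) tail≡) (Δ-prefixParity ys))
  where
  tail≡ : ∀ j → j < length ys →
          (y xor prefixParity ys j) xor (y xor prefixParity ys (suc j)) ≡ Δ (prefixParity ys) j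
  tail≡ j _ = trans (xor-interchange y _ y _) (cong (_xor Δ (prefixParity ys) j) (xor-same y))

-- Neighbourhoods in B̃ₙ

counted : ℕ → ℕ → ℕ → Bool
counted n i j = simpleAdj n i j ∨ ((i ≡ᵇ n) ∧ (j ≡ᵇ n ∸ 1))

neighbourSum : ℕ → ℕ → (ℕ → Bool) → Bool
neighbourSum n p f = xorSum (λ t → counted n p t ∧ f t) (suc n)

neighbourSum-row : ∀ n p qs f → (∀ t → counted n p t ≡ indicator qs t) → All (_< suc n) qs →
                   neighbourSum n p f ≡ xorOver f qs
neighbourSum-row n p qs f row qs< =
  trans (xorSum-cong (suc n) (λ t → cong (_∧ f t) (row t))) (xorSum-indicator (suc n) qs f qs<)

at-move : ∀ n i (a : Labeling n) j →
          at (move (Btilde n) i a) j ≡ update (at a) (toℕ i) (at a (toℕ i) xor neighbourSum n (toℕ i) (at a)) j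
at-move n i a j =
  trans (at-[]≔ a i _ j) (cong (λ b → update (at a) (toℕ i) b j) (cong₂ _xor_ (lookup≡at a i) neighbours))
  where
  row : Fin (suc n) → Bool
  row k = Btilde n i k ∧ lookup a k
  neighbours : foldr′ _xor_ false (map row (allFin (suc n))) ≡ neighbourSum n (toℕ i) (at a)
  neighbours = trans (cong (foldr′ _xor_ false) (sym (tabulate-∘ row (λ k → k))))
                     (foldr-tabulate≡xorSum row (λ t → counted n (toℕ i) t ∧ at a t)
                                            (λ k → cong (Btilde n i k ∧_) (lookup≡at a k)))

module Neighbourhoods (r : ℕ) where

  row-0 : ∀ t → counted (4 + r) 0 t ≡ indicator (2 ∷ []) t
  row-0 0 = refl
  row-0 1 = refl
  row-0 2 = refl
  row-0 (suc (suc (suc t))) with t <ᵇ r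
  ... | true  = refl
  ... | false = refl

  row-1 : ∀ t → counted (4 + r) 1 t ≡ indicator (2 ∷ []) t
  row-1 0 = refl
  row-1 1 = refl
  row-1 2 = refl
  row-1 (suc (suc (suc t))) with t <ᵇ r
  ... | true  = refl
  ... | false = refl

  row-2 : ∀ t → counted (4 + r) 2 t ≡ indicator (0 ∷ 1 ∷ 3 ∷ []) t
  row-2 0 = refl
  row-2 1 = refl
  row-2 2 = refl
  row-2 3 = refl
  row-2 (suc (suc (suc (suc t)))) with suc t <ᵇ r
  ... | true  = refl
  ... | false = refl

  private
    ≢suc-r : ∀ {i} → i ≤ r → i ≢ suc r
    ≢suc-r i≤r refl = n≮n r i≤r

    edge-from-below : ∀ i t → i ≤ r → (t <ᵇ suc r) ∧ (i ≡ᵇ t) ≡ (t ≡ᵇ i)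
    edge-from-below i t i≤r with t ≟ i
    ... | yes refl rewrite dec-true (i <? suc r) (s≤s i≤r) | dec-true (i ≟ i) refl = refl
    ... | no t≢i   rewrite dec-false (i ≟ t) (t≢i ∘ sym) | dec-false (t ≟ i) t≢i = ∧-zeroʳ (t <ᵇ suc r)

  row-middle : ∀ i t → i < r → counted (4 + r) (3 + i) t ≡ indicator (2 + i ∷ 4 + i ∷ []) t
  row-middle i 0 i<r rewrite dec-true (i <? r) i<r | dec-false (i ≟ suc r) (≢suc-r (<⇒≤ i<r)) = refl
  row-middle i 1 i<r rewrite dec-true (i <? r) i<r | dec-false (i ≟ suc r) (≢suc-r (<⇒≤ i<r)) = refl
  row-middle i (suc (suc t)) i<r
    rewrite dec-true (i <? r) i<r | dec-false (i ≟ suc r) (≢suc-r (<⇒≤ i<r)) | edge-from-below i t (<⇒≤ i<r)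
    with t ≟ i
  ... | yes refl rewrite dec-true (i ≟ i) refl | dec-false (i ≟ suc (suc i)) (λ ()) = refl
  ... | no t≢i   rewrite dec-false (t ≟ i) t≢i with t ≡ᵇ suc (suc i)
  ...   | true  = refl
  ...   | false = refl

  row-penultimate : ∀ t → counted (4 + r) (3 + r) t ≡ indicator (2 + r ∷ []) t
  row-penultimate 0 rewrite dec-false (r <? r) (n≮n r) | dec-false (r ≟ suc r) (≢suc-r ≤-refl) = refl
  row-penultimate 1 rewrite dec-false (r <? r) (n≮n r) | dec-false (r ≟ suc r) (≢suc-r ≤-refl) = refl
  row-penultimate (suc (suc t))
    rewrite dec-false (r <? r) (n≮n r) | dec-false (r ≟ suc r) (≢suc-r ≤-refl) | edge-from-below r t ≤-refl =
    trans (∨-identityʳ (t ≡ᵇ r)) (sym (xor-identityʳ (t ≡ᵇ r)))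

  row-last : ∀ t → counted (4 + r) (4 + r) t ≡ indicator (3 + r ∷ []) t
  row-last 0 rewrite dec-false (suc r <? r) (n≮n r ∘ <-trans (n<1+n r)) | dec-true (r ≟ r) refl = refl
  row-last 1 rewrite dec-false (suc r <? r) (n≮n r ∘ <-trans (n<1+n r)) | dec-true (r ≟ r) refl = refl
  row-last (suc (suc t)) rewrite dec-false (suc r <? r) (n≮n r ∘ <-trans (n<1+n r)) | dec-true (r ≟ r) refl
    with t ≟ suc r
  ... | yes refl rewrite dec-false (suc r <? suc r) (n≮n (suc r)) | dec-true (r ≟ r) refl = refl
  ... | no t≢    rewrite dec-false (suc r ≟ t) (t≢ ∘ sym) | dec-false (t ≟ suc r) t≢
                          | ∧-zeroʳ (t <ᵇ suc r) = refl

-- Coordinates of a labeling of B̃₄₊ᵣ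

module LabelingCoordinates (r : ℕ) where
  open Neighbourhoods r

  -- The word z of the proof sketch, zero beyond n.
  path : (ℕ → Bool) → ℕ → Bool
  path f 0             = false
  path f 1             = f 0 xor f 1
  path f (suc (suc j)) = (j <ᵇ 2 + r) ∧ f (2 + j)

  path-cong : ∀ {f g} → (∀ t → f t ≡ g t) → ∀ j → path f j ≡ path g j
  path-cong eq 0             = refl
  path-cong eq 1             = cong₂ _xor_ (eq 0) (eq 1)
  path-cong eq (suc (suc j)) = cong ((j <ᵇ 2 + r) ∧_) (eq (2 + j))

  path-interior : ∀ f j → j < 2 + r → path f (2 + j) ≡ f (2 + j)
  path-interior f j j< rewrite dec-true (j <? 2 + r) j< = refl

  path-end : ∀ f → path f (4 + r) ≡ false
  path-end f rewrite dec-false (2 + r <? 2 + r) (n≮n (2 + r)) = refl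

  neighbourSum-first : ∀ f → neighbourSum (4 + r) 0 f ≡ f 2 xor false
  neighbourSum-first f = neighbourSum-row (4 + r) 0 _ f row-0 (s≤s (s≤s (s≤s z≤n)) ∷ [])

  neighbourSum-last : ∀ f → neighbourSum (4 + r) (4 + r) f ≡ f (3 + r) xor false
  neighbourSum-last f = neighbourSum-row (4 + r) (4 + r) _ f row-last (s≤s (s≤s (s≤s (s≤s (n≤1+n r)))) ∷ [])

  neighbourSum-interior : ∀ p f → 1 ≤ p → p ≤ 3 + r →
                          neighbourSum (4 + r) p f ≡ path f (p ∸ 1) xor path f (suc p)
  neighbourSum-interior 1 f _ _ =
    trans (neighbourSum-row (4 + r) 1 _ f row-1 (s≤s (s≤s (s≤s z≤n)) ∷ [])) (xor-identityʳ (f 2))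
  neighbourSum-interior 2 f _ _ =
    trans (neighbourSum-row (4 + r) 2 _ f row-2 (s≤s z≤n ∷ s≤s (s≤s z≤n) ∷ s≤s (s≤s (s≤s (s≤s z≤n))) ∷ []))
          (trans (cong (λ b → f 0 xor (f 1 xor b)) (xor-identityʳ (f 3))) (sym (xor-assoc (f 0) (f 1) (f 3))))
  neighbourSum-interior (suc (suc (suc i))) f _ p≤ with i <? r
  ... | yes i<r =
    trans (neighbourSum-row (4 + r) (3 + i) _ f (λ t → row-middle i t i<r)
             (s≤s (s≤s (s≤s (≤-trans (<⇒≤ i<r) (m≤n+m r 2)))) ∷ +-monoʳ-≤ 5 (<⇒≤ i<r) ∷ []))
          (trans (cong (f (2 + i) xor_) (xor-identityʳ (f (4 + i))))
                 (sym (cong₂ _xor_ (path-interior f i (≤-trans i<r (m≤n+m r 2)))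
                                   (path-interior f (2 + i) (s≤s (s≤s i<r))))))
  ... | no i≮r with refl ← ≤-antisym (≤-pred (≤-pred (≤-pred p≤))) (≮⇒≥ i≮r) =
    trans (neighbourSum-row (4 + r) (3 + r) _ f row-penultimate (s≤s (s≤s (s≤s (m≤n+m r 2))) ∷ []))
          (sym (cong₂ _xor_ (path-interior f r (≤-trans (n<1+n r) (n≤1+n (suc r)))) (path-end f)))

  path-update : ∀ f p w j → 1 ≤ p → p ≤ 3 + r →
                path (update f p (f p xor w)) j ≡ update (path f) p (path f p xor w) j
  path-update f 1 w 0             _ _ = refl
  path-update f 1 w 1             _ _ = sym (xor-assoc (f 0) (f 1) w)
  path-update f 1 w (suc (suc j)) _ _ = refl
  path-update f (suc (suc p)) w 0 _ _ = refl
  path-update f (suc (suc p)) w 1 _ _ = refl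
  path-update f (suc (suc p)) w (suc (suc j)) _ p≤ with p ≟ j
  ... | yes refl rewrite dec-true (p ≟ p) refl | dec-true (p <? 2 + r) (≤-pred p≤) = refl
  ... | no p≢j   rewrite dec-false (p ≟ j) p≢j = refl

  moveℕ : (ℕ → Bool) → ℕ → ℕ → Bool
  moveℕ f p = update f p (f p xor neighbourSum (4 + r) p f)

  path-move-interior : ∀ f p j → 1 ≤ p → p ≤ 3 + r → path (moveℕ f p) j ≡ flipAt (path f) p j
  path-move-interior f p j 1≤p p≤ =
    trans (path-update f p _ j 1≤p p≤)
          (cong (λ w → update (path f) p (path f p xor w) j) (neighbourSum-interior p f 1≤p p≤))

  path-move-first : ∀ f j → path (moveℕ f 0) j ≡ flipAt (path f) 1 j
  path-move-first f 0             = refl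
  path-move-first f 1             = begin
    (f 0 xor neighbourSum (4 + r) 0 f) xor f 1
      ≡⟨ cong (λ b → (f 0 xor b) xor f 1) (trans (neighbourSum-first f) (xor-identityʳ (f 2))) ⟩
    (f 0 xor f 2) xor f 1
      ≡⟨ xy∙z≈xz∙y (f 0) (f 2) (f 1) ⟩
    (f 0 xor f 1) xor f 2 ∎
    where open ≡-Reasoning
  path-move-first f (suc (suc j)) = refl

  path-move-last : ∀ f j → path (moveℕ f (4 + r)) j ≡ path f j
  path-move-last f 0             = refl
  path-move-last f 1             = refl
  path-move-last f (suc (suc j)) with j ≟ 2 + r
  ... | yes refl rewrite dec-false (2 + r <? 2 + r) (n≮n (2 + r)) = refl
  ... | no j≢    rewrite dec-false (2 + r ≟ j) (j≢ ∘ sym) = refl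

  differences : Labeling (4 + r) → List Bool
  differences a = applyUpTo (Δ (path (at a))) (4 + r)

  coordinates : Labeling (4 + r) → Coordinates
  coordinates a = at a 0 , differences a , at a (4 + r)

  length-differences : ∀ a → length (differences a) ≡ 4 + r
  length-differences a = length-applyUpTo (Δ (path (at a))) (4 + r)

  coordinates-admissible : ∀ a → length (differences a) ≡ 4 + r × parity (differences a) ≡ false
  coordinates-admissible a = length-differences a , trans (parity-Δ (4 + r) (path (at a))) (path-end (at a))

  T : Fin (5 + r) → Labeling (4 + r) → Labeling (4 + r)
  T = move (Btilde (4 + r))

  at-T : ∀ i a p → toℕ i ≡ p → ∀ j → at (T i a) j ≡ moveℕ (at a) p j
  at-T i a p refl = at-move (4 + r) i a

  differences-flip : ∀ a b q → q ≤ 2 + r → (∀ j → path (at b) j ≡ flipAt (path (at a)) (suc q) j) →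
                     differences b ≡ swapAt q (differences a)
  differences-flip a b q q≤ path≡ = applyUpTo-swapAt q (4 + r) (s≤s (s≤s q≤))
    (trans (Δ≡ q) (Δ-flip-left (path (at a)) q)) (trans (Δ≡ (suc q)) (Δ-flip-right (path (at a)) q))
    (λ j j≢q j≢sq → trans (Δ≡ j) (Δ-flip-other (path (at a)) q j j≢q j≢sq))
    where
    Δ≡ : ∀ j → Δ (path (at b)) j ≡ Δ (flipAt (path (at a)) (suc q)) j
    Δ≡ j = cong₂ _xor_ (path≡ j) (path≡ (suc j))

  coordinates-T-interior : ∀ i a q → toℕ i ≡ suc q → q ≤ 2 + r →
                           coordinates (T i a) ≡ (at a 0 , swapAt q (differences a) , at a (4 + r))
  coordinates-T-interior i a q i≡ q≤ = cong₂ _,_ (at-T i a (suc q) i≡ 0) (cong₂ _,_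
    (differences-flip a (T i a) q q≤
       (λ j → trans (path-cong (at-T i a (suc q) i≡) j)
                    (path-move-interior (at a) (suc q) j (s≤s z≤n) (s≤s q≤))))
    (trans (at-T i a (suc q) i≡ (4 + r)) (update-other (at a) (suc q) _ (4 + r) sq≢n)))
    where
    sq≢n : suc q ≢ 4 + r
    sq≢n e = n≮n (2 + r) (subst (_≤ 2 + r) (suc-injective e) q≤)

  coordinates-T-first : ∀ i a → toℕ i ≡ 0 →
    coordinates (T i a) ≡
      (at a 0 xor (Δ (path (at a)) 0 xor Δ (path (at a)) 1) , swapAt 0 (differences a) , at a (4 + r))
  coordinates-T-first i a i≡ = cong₂ _,_ a₀≡ (cong₂ _,_
    (differences-flip a (T i a) 0 z≤n (λ j → trans (path-cong (at-T i a 0 i≡) j) (path-move-first (at a) j)))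
    (at-T i a 0 i≡ (4 + r)))
    where
    f = at a
    a₀≡ : at (T i a) 0 ≡ f 0 xor (Δ (path f) 0 xor Δ (path f) 1)
    a₀≡ = trans (at-T i a 0 i≡ 0) (cong (f 0 xor_) (begin
      neighbourSum (4 + r) 0 f       ≡⟨ trans (neighbourSum-first f) (xor-identityʳ (f 2)) ⟩
      f 2                            ≡⟨ sym (xor-absorb (f 0 xor f 1) (f 2)) ⟩
      Δ (path f) 0 xor Δ (path f) 1  ∎))
      where open ≡-Reasoning

  coordinates-T-last : ∀ i a → toℕ i ≡ 4 + r →
    coordinates (T i a) ≡ (at a 0 , differences a , at a (4 + r) xor lastBit (differences a))
  coordinates-T-last i a i≡ = cong₂ _,_ (at-T i a (4 + r) i≡ 0) (cong₂ _,_
    (applyUpTo-cong (4 + r) (λ j _ → cong₂ _xor_ (path≡ j) (path≡ (suc j))))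
    (trans (at-T i a (4 + r) i≡ (4 + r)) (trans (update-same f (4 + r) _) (cong (f (4 + r) xor_) (begin
      neighbourSum (4 + r) (4 + r) f  ≡⟨ neighbourSum-last f ⟩
      f (3 + r) xor false             ≡⟨ sym (cong₂ _xor_ (path-interior f (suc r) (s≤s (n<1+n r))) (path-end f)) ⟩
      Δ (path f) (3 + r)              ≡⟨ sym (lastBit-applyUpTo (3 + r) (Δ (path f))) ⟩
      lastBit (differences a)         ∎)))))
    where
    open ≡-Reasoning
    f = at a
    path≡ : ∀ j → path (at (T i a)) j ≡ path f j
    path≡ j = trans (path-cong (at-T i a (4 + r) i≡) j) (path-move-last f j)

  coordinates-T : ∀ i a → coordinates a ⟶ coordinates (T i a)
  coordinates-T i a = step-at (toℕ i) refl
    where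
    step-at : ∀ p → toℕ i ≡ p → coordinates a ⟶ coordinates (T i a)
    step-at zero    i≡ = subst (coordinates a ⟶_) (sym (coordinates-T-first i a i≡)) swap-first
    step-at (suc q) i≡ with q ≤? 2 + r
    ... | yes q≤ = subst (coordinates a ⟶_) (sym (coordinates-T-interior i a q i≡ q≤))
                     (transpose (q , subst (suc q <_) (sym (length-differences a)) (s≤s (s≤s q≤)) , refl))
    ... | no q≰ =
      subst (coordinates a ⟶_) (sym (coordinates-T-last i a (trans i≡ (cong suc q≡3+r)))) toggle-last
      where q≡3+r = ≤-antisym (≤-pred (≤-pred (subst (_< 5 + r) i≡ (toℕ<n i)))) (≰⇒> q≰)

  Equiv⇒⟶⋆ : ∀ {a b} → Equiv (Btilde (4 + r)) a b → coordinates a ⟶⋆ coordinates b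
  Equiv⇒⟶⋆ ε                     = ε
  Equiv⇒⟶⋆ {a} ((i , refl) ◅ ss) = coordinates-T i a ◅ Equiv⇒⟶⋆ ss

  ⟶⇒Step : ∀ a {c c′} → coordinates a ≡ c → c ⟶ c′ →
           ∃[ b ] Step (Btilde (4 + r)) a b × coordinates b ≡ c′
  ⟶⇒Step a refl (transpose (q , q< , refl)) =
    T i a , (i , refl) , coordinates-T-interior i a q (toℕ-fromℕ< i<) q≤
    where
    q≤ : q ≤ 2 + r
    q≤ = ≤-pred (≤-pred (subst (suc q <_) (length-differences a) q<))
    i< : suc q < 5 + r
    i< = s≤s (s≤s (m≤n⇒m≤1+n q≤))
    i = fromℕ< i<
  ⟶⇒Step a refl swap-first  = T Fin.zero a , (Fin.zero , refl) , coordinates-T-first Fin.zero a refl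
  ⟶⇒Step a refl toggle-last =
    T (fromℕ (4 + r)) a , (fromℕ (4 + r) , refl) , coordinates-T-last (fromℕ (4 + r)) a (toℕ-fromℕ (4 + r))

  ⟶⋆⇒Equiv : ∀ a {c c′} → coordinates a ≡ c → c ⟶⋆ c′ →
             ∃[ b ] Equiv (Btilde (4 + r)) a b × coordinates b ≡ c′
  ⟶⋆⇒Equiv a eq ε = a , ε , eq
  ⟶⋆⇒Equiv a eq (s ◅ ss) with ⟶⇒Step a eq s
  ... | b , step , eq′ with ⟶⋆⇒Equiv b eq′ ss
  ...   | c , steps , eq″ = c , step ◅ steps , eq″

  coordinates-injective : ∀ a b → coordinates a ≡ coordinates b → a ≡ b
  coordinates-injective a b eq = at-injective a b agree
    where
    path≡ : ∀ j → j ≤ 4 + r → path (at a) j ≡ path (at b) j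
    path≡ = Δ-determines (4 + r) _ _ refl (applyUpTo-≡⇒≗ (4 + r) (cong (proj₁ ∘ proj₂) eq))
    agree : ∀ j → j < 5 + r → at a j ≡ at b j
    agree 0 _ = cong proj₁ eq
    agree 1 _ = begin
      at a 1                    ≡⟨ sym (xor-absorb (at a 0) (at a 1)) ⟩
      at a 0 xor path (at a) 1  ≡⟨ cong₂ _xor_ (agree 0 (s≤s z≤n)) (path≡ 1 (s≤s z≤n)) ⟩
      at b 0 xor path (at b) 1  ≡⟨ xor-absorb (at b 0) (at b 1) ⟩
      at b 1                    ∎
      where open ≡-Reasoning
    agree (suc (suc j)) j< with j <? 2 + r
    ... | yes j<2+r =
      trans (sym (path-interior (at a) j j<2+r)) (trans (path≡ (2 + j) (≤-pred j<)) (path-interior (at b) j j<2+r))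
    ... | no  j≮ with refl ← ≤-antisym (≤-pred (≤-pred (≤-pred j<))) (≮⇒≥ j≮) =
      cong (proj₂ ∘ proj₂) eq

  coordinates-surjective : ∀ a₀ ys aₙ → length ys ≡ 4 + r → parity ys ≡ false →
                           ∃[ a ] coordinates a ≡ (a₀ , ys , aₙ)
  coordinates-surjective a₀ ys aₙ len par = a , cong₂ _,_ refl (cong₂ _,_ differences≡ aₙ≡)
    where
    h : ℕ → Bool
    h 0             = a₀
    h 1             = a₀ xor prefixParity ys 1
    h (suc (suc j)) = if j <ᵇ 2 + r then prefixParity ys (2 + j) else aₙ
    a : Labeling (4 + r)
    a = tabulate (λ k → h (toℕ k))
    at-a : ∀ j → j < 5 + r → at a j ≡ h j
    at-a = at-tabulate (5 + r) h
    aₙ≡ : at a (4 + r) ≡ aₙ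
    aₙ≡ rewrite at-a (4 + r) ≤-refl | dec-false (2 + r <? 2 + r) (n≮n (2 + r)) = refl
    path≡ : ∀ j → j ≤ 4 + r → path (at a) j ≡ prefixParity ys j
    path≡ 0 _ = refl
    path≡ 1 _ = xor-absorb a₀ (prefixParity ys 1)
    path≡ (suc (suc j)) j≤ with j <? 2 + r
    ... | yes j< rewrite at-a (2 + j) (s≤s j≤) | dec-true (j <? 2 + r) j< = refl
    ... | no  j≮ with refl ← ≤-antisym (≤-pred (≤-pred j≤)) (≮⇒≥ j≮)
      rewrite dec-false (2 + r <? 2 + r) (n≮n (2 + r)) =
      sym (trans (cong (prefixParity ys) (sym len)) (trans (prefixParity-length ys) par))
    differences≡ : differences a ≡ ys
    differences≡ = begin
      applyUpTo (Δ (path (at a))) (4 + r)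
        ≡⟨ applyUpTo-cong (4 + r) (λ j j< → cong₂ _xor_ (path≡ j (<⇒≤ j<)) (path≡ (suc j) j<)) ⟩
      applyUpTo (Δ (prefixParity ys)) (4 + r)
        ≡⟨ cong (applyUpTo (Δ (prefixParity ys))) (sym len) ⟩
      applyUpTo (Δ (prefixParity ys)) (length ys)
        ≡⟨ Δ-prefixParity ys ⟩
      ys ∎
      where open ≡-Reasoning

Btilde-classes : ∀ m → HasExactlyClasses (Btilde (4 + (m + m))) (7 + m)
Btilde-classes m = representativeLabeling , distinct , reach
  where
  open LabelingCoordinates (m + m)
  open Classification m

  realise : ∀ c → Admissible m c → ∃[ a ] coordinates a ≡ c
  realise (a₀ , ys , aₙ) (len , par) = coordinates-surjective a₀ ys aₙ len par

  realise-representative : ∀ x → ∃[ a ] coordinates a ≡ representative m (toℕ x)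
  realise-representative x = realise (representative m (toℕ x)) (representative-admissible (toℕ x) (toℕ<n x))

  representativeLabeling : Fin (7 + m) → Labeling (4 + (m + m))
  representativeLabeling x = proj₁ (realise-representative x)

  index : ∀ x → classIndex (coordinates (representativeLabeling x)) ≡ toℕ x
  index x = trans (cong classIndex (proj₂ (realise-representative x))) (classIndex-representative (toℕ x))

  distinct : ∀ x y → Equiv (Btilde (4 + (m + m))) (representativeLabeling x) (representativeLabeling y) → x ≡ y
  distinct x y e = toℕ-injective (trans (sym (index x)) (trans (classIndex-⟶⋆ (Equiv⇒⟶⋆ e)) (index y)))

  reach : ∀ a → ∃ λ x → Equiv (Btilde (4 + (m + m))) a (representativeLabeling x)
  reach a with reach-representative (coordinates a) (coordinates-admissible a)
  ... | bound , walk with ⟶⋆⇒Equiv a refl walk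
  ...   | b , a~b , b≡ =
    x , subst (Equiv (Btilde (4 + (m + m))) a) (coordinates-injective b (representativeLabeling x) b≡rep) a~b
    where
    x = fromℕ< bound
    b≡rep : coordinates b ≡ coordinates (representativeLabeling x)
    b≡rep = trans b≡ (trans (cong (representative m) (sym (toℕ-fromℕ< bound)))
                            (sym (proj₂ (realise-representative x))))

proposition2p19 : (k : ℕ) → 2 ≤ k → HasExactlyClasses (Btilde (2 * k)) (k + 5)
proposition2p19 (suc zero)    (s≤s ())
proposition2p19 (suc (suc m)) _ =
  subst₂ (λ n c → HasExactlyClasses (Btilde n) c) (size m) (count m) (Btilde-classes m)
  where
  size : ∀ m → 4 + (m + m) ≡ 2 * (2 + m)
  size = solve-∀
  count : ∀ m → 7 + m ≡ (2 + m) + 5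
  count = solve-∀
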